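{- For every $n\ge 1$, the number of directed paths (equivalently, integer $1$-flows) from $a_1$ to $b_n$ in $F_n$ equals \[\begin{bmatrix}1\\1\end{bmatrix}^T\begin{bmatrix}2&1\\1&1\end{bmatrix}^{n-1}\begin{bmatrix}0\\1\end{bmatrix}.\]
   Context: $F_n$ is the directed bipartite graph on vertex set $\{a_1,\dots,a_n\}\cup\{b_1,\dots,b_n\}$ with an arc $a_i\to b_j$ if and only if $i\le j$, and an arc $b_j\to a_i$ if and only if $j<i$ (and no other arcs). -}

module Defs where

open import Data.Nat using (ℕ; _+_; _*_; _≤_; _<_)
open import Data.Fin using (Fin; zero; suc)
open import Data.List using (List; head; last; length)
open import Data.Maybe using (just)
open import Data.Product using (_×_)
open import Data.List.Relation.Unary.All using (All)
open import Data.List.Relation.Unary.Linked using (Linked)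
open import Data.List.Relation.Unary.Unique.Propositional using (Unique)
open import Relation.Binary.PropositionalEquality using (_≡_)

-- Vertices a_i and b_i, 1-indexed as in the paper.
data V : Set where
  a : ℕ → V
  b : ℕ → V

data IsVertex (n : ℕ) : V → Set where
  va : ∀ {i} → 1 ≤ i → i ≤ n → IsVertex n (a i)
  vb : ∀ {i} → 1 ≤ i → i ≤ n → IsVertex n (b i)

data Arc (n : ℕ) : V → V → Set where
  ab : ∀ {i j} → 1 ≤ i → i ≤ j → j ≤ n → Arc n (a i) (b j)
  ba : ∀ {i j} → 1 ≤ j → j < i → i ≤ n → Arc n (b j) (a i)

IsDirectedPath : (n : ℕ) → V → V → List V → Set
IsDirectedPath n s t xs =
  All (IsVertex n) xs × Linked (Arc n) xs × Unique xs
  × head xs ≡ just s × last xs ≡ just t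

Mat2 : Set
Mat2 = Fin 2 → Fin 2 → ℕ

Vec2 : Set
Vec2 = Fin 2 → ℕ

_⊗_ : Mat2 → Mat2 → Mat2
(A ⊗ B) i j = A i zero * B zero j + A i (suc zero) * B (suc zero) j

I₂ : Mat2
I₂ zero zero = 1
I₂ zero (suc zero) = 0
I₂ (suc zero) zero = 0
I₂ (suc zero) (suc zero) = 1

_^^_ : Mat2 → ℕ → Mat2
A ^^ ℕ.zero = I₂
A ^^ ℕ.suc k = A ⊗ (A ^^ k)

_·v_ : Mat2 → Vec2 → Vec2
(A ·v v) i = A i zero * v zero + A i (suc zero) * v (suc zero)

dot : Vec2 → Vec2 → ℕ
dot u v = u zero * v zero + u (suc zero) * v (suc zero)

M : Mat2
M zero zero = 2
M zero (suc zero) = 1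
M (suc zero) zero = 1
M (suc zero) (suc zero) = 1

u₁₁ : Vec2
u₁₁ _ = 1

e₂ : Vec2
e₂ zero = 0
e₂ (suc zero) = 1

-- Every arc of F_n goes up in the order a_1 < b_1 < a_2 < b_2 < …, so walks never repeat a
-- vertex and directed paths are just walks.  Let P_r count the paths from a_i to b_(i+r) and
-- Q_r those from b_j to b_(j+r).  Splitting on the first arc gives P_r = Q_0 + … + Q_r and
-- Q_(r+1) = P_0 + … + P_r, so X_r = Q_r for r ≥ 1, X_0 = 0, and Y_r = P_r − X_r satisfy
-- (X, Y)_(r+1) = M (X, Y)_r with (X, Y)_0 = e₂, and P_(n−1) = X_(n−1) + Y_(n−1).
module Submission where

open import Defs
open import Data.Nat using (ℕ; zero; suc; _+_; _*_; _≤_; _<_; _∸_; s≤s)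
open import Data.Nat.Properties
open import Data.Fin using () renaming (zero to fz; suc to fs)
open import Data.List using (List; []; _∷_; [_]; map; _++_; head; last; length)
open import Data.List.Properties using (∷-injectiveˡ; ∷-injectiveʳ; length-map; length-++)
open import Data.Maybe using (just)
open import Data.Product using (Σ; _×_; _,_; proj₁; proj₂)
open import Data.Sum using (inj₁; inj₂)
open import Data.Empty using (⊥-elim)
open import Relation.Nullary using (¬_)
open import Relation.Binary.PropositionalEquality
  using (_≡_; refl; sym; trans; cong; cong₂; subst)
open import Data.List.Relation.Unary.All as All using (All; []; _∷_)
open import Data.List.Relation.Unary.Linked using (Linked; [-]; _∷_)
open import Data.List.Relation.Unary.Any using (here)
import Data.List.Relation.Unary.AllPairs as AllPairs
open import Data.List.Relation.Unary.Unique.Propositional using (Unique)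
import Data.List.Relation.Unary.Unique.Propositional.Properties as Unique
open import Data.List.Membership.Propositional using (_∈_)
open import Data.List.Membership.Propositional.Properties
  using (∈-map⁺; ∈-map⁻; ∈-++⁺ˡ; ∈-++⁺ʳ; ∈-++⁻)
open import Data.Nat.Tactic.RingSolver using (solve-∀)

data Walk (n : ℕ) (t : V) : V → List V → Set where
  stop : IsVertex n t → Walk n t t (t ∷ [])
  step : ∀ {v w xs} → Arc n v w → Walk n t w xs → Walk n t v (v ∷ xs)

rank : V → ℕ
rank (a i) = i + i
rank (b j) = suc (j + j)

index : V → ℕ
index (a i) = i
index (b j) = j

arc-rank : ∀ {n v w} → Arc n v w → rank v < rank w
arc-rank (ab _ i≤j _) = s≤s (+-mono-≤ i≤j i≤j)
arc-rank {w = a i} (ba {j = j} _ j<i _) =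
  subst (_≤ i + i) (cong suc (+-suc j j)) (+-mono-≤ j<i j<i)

arc-index : ∀ {n v w} → Arc n v w → index v ≤ index w
arc-index (ab _ i≤j _) = i≤j
arc-index (ba _ j<i _) = <⇒≤ j<i

walk-index : ∀ {n t v xs} → Walk n t v xs → index v ≤ index t
walk-index (stop _) = ≤-refl
walk-index (step e w) = ≤-trans (arc-index e) (walk-index w)

walk-source : ∀ {n t v xs} → Walk n t v xs → IsVertex n v
walk-source (stop t∈) = t∈
walk-source (step (ab 1≤i i≤j j≤n) _) = va 1≤i (≤-trans i≤j j≤n)
walk-source (step (ba 1≤j j<i i≤n) _) = vb 1≤j (≤-trans (<⇒≤ j<i) i≤n)

walk-rank : ∀ {n t v xs} → Walk n t v xs → All (λ x → rank v ≤ rank x) xs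
walk-rank (stop _) = ≤-refl ∷ []
walk-rank (step e w) = ≤-refl ∷ All.map (≤-trans (<⇒≤ (arc-rank e))) (walk-rank w)

walk-vertices : ∀ {n t v xs} → Walk n t v xs → All (IsVertex n) xs
walk-vertices (stop t∈) = t∈ ∷ []
walk-vertices (step e w) = walk-source (step e w) ∷ walk-vertices w

walk-linked : ∀ {n t v xs} → Walk n t v xs → Linked (Arc n) xs
walk-linked (stop _) = [-]
walk-linked (step e (stop _)) = e ∷ [-]
walk-linked (step e (step e′ w)) = e ∷ walk-linked (step e′ w)

walk-unique : ∀ {n t v xs} → Walk n t v xs → Unique xs
walk-unique (stop _) = [] AllPairs.∷ AllPairs.[]
walk-unique (step e w) =
  All.map (λ v≤x v≡x → <⇒≱ (arc-rank e) (subst (λ y → _ ≤ rank y) (sym v≡x) v≤x)) (walk-rank w)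
  AllPairs.∷ walk-unique w

walk-head : ∀ {n t v xs} → Walk n t v xs → head xs ≡ just v
walk-head (stop _) = refl
walk-head (step _ _) = refl

walk-last : ∀ {n t v xs} → Walk n t v xs → last xs ≡ just t
walk-last (stop _) = refl
walk-last (step _ (stop _)) = refl
walk-last (step _ (step e w)) = walk-last (step e w)

walk⇒path : ∀ {n s t xs} → Walk n t s xs → IsDirectedPath n s t xs
walk⇒path w = walk-vertices w , walk-linked w , walk-unique w , walk-head w , walk-last w

path⇒walk : ∀ {n s t} xs → IsDirectedPath n s t xs → Walk n t s xs
path⇒walk (x ∷ []) (x∈ ∷ [] , _ , _ , refl , refl) = stop x∈
path⇒walk (x ∷ y ∷ xs) (_ ∷ ∈s , e ∷ linked , _ AllPairs.∷ unique , refl , lst) =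
  step e (path⇒walk (y ∷ xs) (∈s , linked , unique , refl , lst))

-- The second argument r is the distance to the target: pathsA i r lists the walks from a i to
-- b (i + r), and pathsA≥ i r those from any a k with i ≤ k ≤ i + r; likewise for b.
mutual
  pathsA : ℕ → ℕ → List (List V)
  pathsA i r = map (a i ∷_) (pathsB≥ i r)

  pathsB≥ : ℕ → ℕ → List (List V)
  pathsB≥ j zero = pathsB j zero
  pathsB≥ j (suc r) = pathsB j (suc r) ++ pathsB≥ (suc j) r

  pathsB : ℕ → ℕ → List (List V)
  pathsB j zero = [ [ b j ] ]
  pathsB j (suc r) = map (b j ∷_) (pathsA≥ (suc j) r)

  pathsA≥ : ℕ → ℕ → List (List V)
  pathsA≥ i zero = pathsA i zero
  pathsA≥ i (suc r) = pathsA i (suc r) ++ pathsA≥ (suc i) r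

+-suc-shift : ∀ {j r t} → j + suc r ≡ t → suc j + r ≡ t
+-suc-shift {j} {r} e = trans (sym (+-suc j r)) e

module _ {n t : ℕ} (t≤n : t ≤ n) where
  mutual
    pathsA-sound : ∀ {i r xs} → 1 ≤ i → i + r ≡ t → xs ∈ pathsA i r → Walk n (b t) (a i) xs
    pathsA-sound 1≤i e xs∈ with ∈-map⁻ _ xs∈
    ... | _ , ys∈ , refl with pathsB≥-sound 1≤i e ys∈
    ... | _ , i≤j , w with walk-source w
    ... | vb _ j≤n = step (ab 1≤i i≤j j≤n) w

    pathsB≥-sound : ∀ {j r xs} → 1 ≤ j → j + r ≡ t → xs ∈ pathsB≥ j r →
                    Σ ℕ λ k → j ≤ k × Walk n (b t) (b k) xs
    pathsB≥-sound {j} {zero} 1≤j e xs∈ = j , ≤-refl , pathsB-sound 1≤j e xs∈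
    pathsB≥-sound {j} {suc r} 1≤j e xs∈ with ∈-++⁻ (pathsB j (suc r)) xs∈
    ... | inj₁ xs∈′ = j , ≤-refl , pathsB-sound 1≤j e xs∈′
    ... | inj₂ xs∈′ with pathsB≥-sound (m≤n⇒m≤1+n 1≤j) (+-suc-shift e) xs∈′
    ... | k , j<k , w = k , <⇒≤ j<k , w

    pathsB-sound : ∀ {j r xs} → 1 ≤ j → j + r ≡ t → xs ∈ pathsB j r → Walk n (b t) (b j) xs
    pathsB-sound {j} {zero} 1≤j e (here refl) rewrite sym (trans (sym (+-identityʳ j)) e) =
      stop (vb 1≤j t≤n)
    pathsB-sound {j} {suc r} 1≤j e xs∈ with ∈-map⁻ _ xs∈
    ... | _ , ys∈ , refl with pathsA≥-sound (m≤n⇒m≤1+n 1≤j) (+-suc-shift e) ys∈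
    ... | _ , j<k , w with walk-source w
    ... | va _ k≤n = step (ba 1≤j j<k k≤n) w

    pathsA≥-sound : ∀ {i r xs} → 1 ≤ i → i + r ≡ t → xs ∈ pathsA≥ i r →
                    Σ ℕ λ k → i ≤ k × Walk n (b t) (a k) xs
    pathsA≥-sound {i} {zero} 1≤i e xs∈ = i , ≤-refl , pathsA-sound 1≤i e xs∈
    pathsA≥-sound {i} {suc r} 1≤i e xs∈ with ∈-++⁻ (pathsA i (suc r)) xs∈
    ... | inj₁ xs∈′ = i , ≤-refl , pathsA-sound 1≤i e xs∈′
    ... | inj₂ xs∈′ with pathsA≥-sound (m≤n⇒m≤1+n 1≤i) (+-suc-shift e) xs∈′
    ... | k , i<k , w = k , <⇒≤ i<k , w

module _ {n t : ℕ} where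
  beyond-target : ∀ {j v xs} → j + zero ≡ t → j < index v → ¬ Walk n (b t) v xs
  beyond-target {j} e j<v w =
    <⇒≱ j<v (subst (_ ≤_) (trans (sym e) (+-identityʳ j)) (walk-index w))

  mutual
    pathsA-complete : ∀ {i r xs} → i + r ≡ t → Walk n (b t) (a i) xs → xs ∈ pathsA i r
    pathsA-complete e (step (ab _ i≤j _) w) = ∈-map⁺ _ (pathsB≥-complete i≤j e w)

    pathsB≥-complete : ∀ {j k r xs} → j ≤ k → j + r ≡ t → Walk n (b t) (b k) xs →
                       xs ∈ pathsB≥ j r
    pathsB≥-complete j≤k e w with m≤n⇒m<n∨m≡n j≤k
    pathsB≥-complete {r = zero} _ e w | inj₂ refl = pathsB-complete e w
    pathsB≥-complete {r = suc r} _ e w | inj₂ refl = ∈-++⁺ˡ (pathsB-complete e w)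
    pathsB≥-complete {r = zero} _ e w | inj₁ j<k = ⊥-elim (beyond-target e j<k w)
    pathsB≥-complete {j} {r = suc r} _ e w | inj₁ j<k =
      ∈-++⁺ʳ (pathsB j (suc r)) (pathsB≥-complete j<k (+-suc-shift e) w)

    pathsB-complete : ∀ {j r xs} → j + r ≡ t → Walk n (b t) (b j) xs → xs ∈ pathsB j r
    pathsB-complete {r = zero} e (stop _) = here refl
    pathsB-complete {j} {suc r} e (stop _) = ⊥-elim (m+1+n≢m j e)
    pathsB-complete {r = zero} e (step (ba _ j<k _) w) = ⊥-elim (beyond-target e j<k w)
    pathsB-complete {r = suc r} e (step (ba _ j<k _) w) =
      ∈-map⁺ _ (pathsA≥-complete j<k (+-suc-shift e) w)

    pathsA≥-complete : ∀ {i k r xs} → i ≤ k → i + r ≡ t → Walk n (b t) (a k) xs →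
                       xs ∈ pathsA≥ i r
    pathsA≥-complete i≤k e w with m≤n⇒m<n∨m≡n i≤k
    pathsA≥-complete {r = zero} _ e w | inj₂ refl = pathsA-complete e w
    pathsA≥-complete {r = suc r} _ e w | inj₂ refl = ∈-++⁺ˡ (pathsA-complete e w)
    pathsA≥-complete {r = zero} _ e w | inj₁ i<k =
      ⊥-elim (beyond-target e i<k w)
    pathsA≥-complete {i} {r = suc r} _ e w | inj₁ i<k =
      ∈-++⁺ʳ (pathsA i (suc r)) (pathsA≥-complete i<k (+-suc-shift e) w)

pathsB≥-head : ∀ {j r xs} → xs ∈ pathsB≥ j r → Σ ℕ λ k → j ≤ k × Σ (List V) λ ys → xs ≡ b k ∷ ys
pathsB≥-head {j} {zero} (here refl) = j , ≤-refl , [] , refl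
pathsB≥-head {j} {suc r} xs∈ with ∈-++⁻ (pathsB j (suc r)) xs∈
... | inj₁ xs∈′ with ∈-map⁻ _ xs∈′
...   | ys , _ , xs≡ = j , ≤-refl , ys , xs≡
pathsB≥-head {j} {suc r} xs∈ | inj₂ xs∈′ with pathsB≥-head {r = r} xs∈′
...   | k , j<k , ys , xs≡ = k , <⇒≤ j<k , ys , xs≡

pathsA≥-head : ∀ {i r xs} → xs ∈ pathsA≥ i r → Σ ℕ λ k → i ≤ k × Σ (List V) λ ys → xs ≡ a k ∷ ys
pathsA≥-head {i} {zero} xs∈ with ∈-map⁻ _ xs∈
... | ys , _ , xs≡ = i , ≤-refl , ys , xs≡
pathsA≥-head {i} {suc r} xs∈ with ∈-++⁻ (pathsA i (suc r)) xs∈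
... | inj₁ xs∈′ with ∈-map⁻ _ xs∈′
...   | ys , _ , xs≡ = i , ≤-refl , ys , xs≡
pathsA≥-head {i} {suc r} xs∈ | inj₂ xs∈′ with pathsA≥-head {r = r} xs∈′
...   | k , i<k , ys , xs≡ = k , <⇒≤ i<k , ys , xs≡

a-injective : ∀ {i j} → a i ≡ a j → i ≡ j
a-injective refl = refl

b-injective : ∀ {i j} → b i ≡ b j → i ≡ j
b-injective refl = refl

mutual
  pathsA-unique : ∀ i r → Unique (pathsA i r)
  pathsA-unique i r = Unique.map⁺ ∷-injectiveʳ (pathsB≥-unique i r)

  pathsB≥-unique : ∀ j r → Unique (pathsB≥ j r)
  pathsB≥-unique j zero = pathsB-unique j zero
  pathsB≥-unique j (suc r) =
    Unique.++⁺ (pathsB-unique j (suc r)) (pathsB≥-unique (suc j) r) disjoint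
    where
    disjoint : ∀ {xs} → ¬ (xs ∈ pathsB j (suc r) × xs ∈ pathsB≥ (suc j) r)
    disjoint (xs∈ , xs∈′) with ∈-map⁻ _ xs∈ | pathsB≥-head {r = r} xs∈′
    ... | _ , _ , xs≡ | _ , j<k , _ , xs≡′ = <⇒≢ j<k (b-injective (∷-injectiveˡ (trans (sym xs≡) xs≡′)))

  pathsB-unique : ∀ j r → Unique (pathsB j r)
  pathsB-unique j zero = [] AllPairs.∷ AllPairs.[]
  pathsB-unique j (suc r) = Unique.map⁺ ∷-injectiveʳ (pathsA≥-unique (suc j) r)

  pathsA≥-unique : ∀ i r → Unique (pathsA≥ i r)
  pathsA≥-unique i zero = pathsA-unique i zero
  pathsA≥-unique i (suc r) =
    Unique.++⁺ (pathsA-unique i (suc r)) (pathsA≥-unique (suc i) r) disjoint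
    where
    disjoint : ∀ {xs} → ¬ (xs ∈ pathsA i (suc r) × xs ∈ pathsA≥ (suc i) r)
    disjoint (xs∈ , xs∈′) with ∈-map⁻ _ xs∈ | pathsA≥-head {r = r} xs∈′
    ... | _ , _ , xs≡ | _ , i<k , _ , xs≡′ = <⇒≢ i<k (a-injective (∷-injectiveˡ (trans (sym xs≡) xs≡′)))

X Y : ℕ → ℕ
X zero = 0
X (suc r) = X r + X r + Y r
Y zero = 1
Y (suc r) = X r + Y r

mutual
  length-pathsA : ∀ i r → length (pathsA i r) ≡ X r + Y r
  length-pathsA i r = trans (length-map _ (pathsB≥ i r)) (length-pathsB≥ i r)

  length-pathsB≥ : ∀ j r → length (pathsB≥ j r) ≡ X r + Y r
  length-pathsB≥ j zero = refl
  length-pathsB≥ j (suc r) =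
    trans (length-++ (pathsB j (suc r)))
      (cong₂ _+_ (length-pathsB-suc j r) (length-pathsB≥ (suc j) r))

  length-pathsB-suc : ∀ j r → length (pathsB j (suc r)) ≡ X (suc r)
  length-pathsB-suc j r = trans (length-map _ (pathsA≥ (suc j) r)) (length-pathsA≥ (suc j) r)

  length-pathsA≥ : ∀ i r → length (pathsA≥ i r) ≡ X (suc r)
  length-pathsA≥ i zero = length-pathsA i zero
  length-pathsA≥ i (suc r) =
    trans (length-++ (pathsA i (suc r)))
      (trans (cong₂ _+_ (length-pathsA i (suc r)) (length-pathsA≥ (suc i) r))
             (rearrange (X (suc r)) (Y (suc r))))
    where
    rearrange : ∀ x y → x + y + x ≡ x + x + y
    rearrange = solve-∀

⊗-·v : ∀ A B v i → ((A ⊗ B) ·v v) i ≡ (A ·v (B ·v v)) i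
⊗-·v A B v i =
  assoc (A i fz) (A i (fs fz)) (B fz fz) (B (fs fz) fz) (B fz (fs fz)) (B (fs fz) (fs fz))
        (v fz) (v (fs fz))
  where
  assoc : ∀ p q c d e f x y →
    (p * c + q * d) * x + (p * e + q * f) * y ≡ p * (c * x + e * y) + q * (d * x + f * y)
  assoc = solve-∀

M-·v : ∀ v → (M ·v v) fz ≡ v fz + v fz + v (fs fz) × (M ·v v) (fs fz) ≡ v fz + v (fs fz)
M-·v v = row₁ (v fz) (v (fs fz)) , row₂ (v fz) (v (fs fz))
  where
  row₁ : ∀ x y → 2 * x + 1 * y ≡ x + x + y
  row₁ = solve-∀
  row₂ : ∀ x y → 1 * x + 1 * y ≡ x + y
  row₂ = solve-∀

M^^-·v-e₂ : ∀ r → ((M ^^ r) ·v e₂) fz ≡ X r × ((M ^^ r) ·v e₂) (fs fz) ≡ Y r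
M^^-·v-e₂ zero = refl , refl
M^^-·v-e₂ (suc r) =
  trans (⊗-·v M (M ^^ r) e₂ fz) (trans (proj₁ (M-·v w)) (cong₂ (λ x y → x + x + y) x≡ y≡)) ,
  trans (⊗-·v M (M ^^ r) e₂ (fs fz)) (trans (proj₂ (M-·v w)) (cong₂ _+_ x≡ y≡))
  where
  w = (M ^^ r) ·v e₂
  x≡ = proj₁ (M^^-·v-e₂ r)
  y≡ = proj₂ (M^^-·v-e₂ r)

dot-u₁₁-M^^-e₂ : ∀ r → dot u₁₁ ((M ^^ r) ·v e₂) ≡ X r + Y r
dot-u₁₁-M^^-e₂ r =
  cong₂ _+_ (trans (*-identityˡ _) (proj₁ (M^^-·v-e₂ r))) (trans (*-identityˡ _) (proj₂ (M^^-·v-e₂ r)))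

mainTheorem9 : (n : ℕ) → 1 ≤ n →
    Σ (List (List V)) λ paths →
    Unique paths
    × (∀ xs → xs ∈ paths → IsDirectedPath n (a 1) (b n) xs)
    × (∀ xs → IsDirectedPath n (a 1) (b n) xs → xs ∈ paths)
    × length paths ≡ dot u₁₁ ((M ^^ (n ∸ 1)) ·v e₂)
mainTheorem9 (suc r) _ =
  pathsA 1 r ,
  pathsA-unique 1 r ,
  (λ xs xs∈ → walk⇒path (pathsA-sound ≤-refl ≤-refl refl xs∈)) ,
  (λ xs path → pathsA-complete refl (path⇒walk xs path)) ,
  trans (length-pathsA 1 r) (sym (dot-u₁₁-M^^-e₂ r))
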